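{- Let $k,l$ be non-negative integers and let $G$ be a Helly graph containing vertices $a,b,c,d,a_b,a_d,c_b,c_d$ such that $\{a,a_b,a_d\}$ and $\{c,c_b,c_d\}$ are triangles of $G$, together with paths from $a_b$ to $b$ of length $l$, from $b$ to $c_b$ of length $k$, from $c_d$ to $d$ of length $l$ and from $d$ to $a_d$ of length $k$, such that in the subgraph $G'$ formed by these triangles and paths $d_{G'}(p,q)=d_G(p,q)$ for all $p,q\in\{a,b,c,d\}$, where $d_G(a,c)=k+l+2$, $d_G(b,d)=k+l+1$, $d_G(a,b)=d_G(c,d)=l+1$ and $d_G(b,c)=d_G(d,a)=k+1$. Then $G$ has an isometric subgraph isomorphic to $H_2^{k,l}$ via an isomorphism sending the corner points $a,b,c,d$ of $H_2^{k,l}$ to the vertices $a,b,c,d$ of $G$, respectively.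
   Context: Graphs are finite, connected, unweighted, undirected and simple; $d_G$ is the shortest-path distance of $G$. A subgraph $H$ of $G$ is isometric if it is induced and $d_H=d_G$ on its vertices. A graph is Helly if every family of pairwise intersecting disks $D(v,r)=\{u:d(u,v)\le r\}$ has a common vertex. King-grid: the graph on $\mathbb{Z}^2$ in which distinct $(x,y),(x',y')$ are adjacent iff $\max(|x-x'|,|y-y'|)=1$. For $u=(x,y)$ let $s(u)=x+y$, $t(u)=x-y$. $H_2^{k,l}$ is the subgraph of the King-grid induced by $\{u: 0\le s(u)\le 2k+1,\ -1\le t(u)\le 2l\}\cup\{(-1,0),(k+l+1,k-l+1)\}$, with corner points $a=(-1,0)$, $b=(l,-l)$, $c=(k+l+1,k-l+1)$, $d=(k,k+1)$. -}

module Defs where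

open import Data.Nat as ℕ using (ℕ; zero; suc; _⊔_)
open import Data.Integer as ℤ using (ℤ; +_; -_; 0ℤ; 1ℤ; -1ℤ; ∣_∣)
open import Data.Fin using (Fin; inject₁; fromℕ)
import Data.Fin as Fin
open import Data.Product using (Σ; ∃; _×_; _,_)
open import Data.Sum using (_⊎_)
open import Data.Empty using (⊥)
open import Relation.Nullary using (¬_)
open import Relation.Binary.PropositionalEquality using (_≡_)
open import Function.Definitions using (Injective)
open import Function.Bundles using (_⇔_)

data Walk {V : Set} (E : V → V → Set) : V → V → ℕ → Set where
  []  : ∀ {u} → Walk E u u 0
  _∷_ : ∀ {u w v m} → E u w → Walk E w v m → Walk E u v (suc m)

Dist : {V : Set} → (V → V → Set) → V → V → ℕ → Set
Dist E u v m = Walk E u v m × (∀ m' → Walk E u v m' → m ℕ.≤ m')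

InDisk : {V : Set} → (V → V → Set) → V → ℕ → V → Set
InDisk E v r u = ∃ λ m → m ℕ.≤ r × Walk E v u m

Helly : {V : Set} → (V → V → Set) → Set₁
Helly {V} E =
  (I : Set) (cen : I → V) (rad : I → ℕ) →
  (∀ i j → ∃ λ u → InDisk E (cen i) (rad i) u × InDisk E (cen j) (rad j) u) →
  ∃ λ u → ∀ i → InDisk E (cen i) (rad i) u

record IsFiniteSimpleConnectedGraph (n : ℕ) (E : Fin n → Fin n → Set) : Set where
  field
    sym       : ∀ {u v} → E u v → E v u
    irrefl    : ∀ {u} → ¬ E u u
    connected : ∀ u v → ∃ λ m → Walk E u v m

Triangle : {V : Set} → (V → V → Set) → V → V → V → Set
Triangle E x y z = E x y × E y z × E x z

IsPath : {V : Set} → (V → V → Set) → (m : ℕ) → (Fin (suc m) → V) → V → V → Set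
IsPath E m P from to =
  P Fin.zero ≡ from × P (fromℕ m) ≡ to ×
  (∀ (i : Fin m) → E (P (inject₁ i)) (P (Fin.suc i))) × Injective _≡_ _≡_ P

PathEdge : {V : Set} → (m : ℕ) → (Fin (suc m) → V) → V → V → Set
PathEdge m P x y = Σ (Fin m) λ i →
  (P (inject₁ i) ≡ x × P (Fin.suc i) ≡ y) ⊎ (P (inject₁ i) ≡ y × P (Fin.suc i) ≡ x)

TriEdge : {V : Set} → V → V → V → V → V → Set
TriEdge x y z u v =
  (u ≡ x × v ≡ y) ⊎ (u ≡ y × v ≡ x) ⊎ (u ≡ y × v ≡ z) ⊎
  (u ≡ z × v ≡ y) ⊎ (u ≡ x × v ≡ z) ⊎ (u ≡ z × v ≡ x)

Point : Set
Point = ℤ × ℤ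

King : Point → Point → Set
King (x , y) (x' , y') = (∣ x ℤ.- x' ∣ ⊔ ∣ y ℤ.- y' ∣) ≡ 1

s t : Point → ℤ
s (x , y) = x ℤ.+ y
t (x , y) = x ℤ.- y

InH : ℕ → ℕ → Point → Set
InH k l u =
  (0ℤ ℤ.≤ s u × s u ℤ.≤ + (2 ℕ.* k ℕ.+ 1) × -1ℤ ℤ.≤ t u × t u ℤ.≤ + (2 ℕ.* l))
  ⊎ u ≡ (-1ℤ , 0ℤ)
  ⊎ u ≡ (+ (k ℕ.+ l ℕ.+ 1) , + k ℤ.- + l ℤ.+ 1ℤ)

EH : ℕ → ℕ → Point → Point → Set
EH k l u v = InH k l u × InH k l v × King u v

cornerA cornerB cornerC cornerD : ℕ → ℕ → Point
cornerA k l = (-1ℤ , 0ℤ)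
cornerB k l = (+ l , - (+ l))
cornerC k l = (+ (k ℕ.+ l ℕ.+ 1) , + k ℤ.- + l ℤ.+ 1ℤ)
cornerD k l = (+ k , + (suc k))

SubEdge : {V : Set} (k l : ℕ) (a ab ad c cb cd : V)
  (P₁ : Fin (suc l) → V) (P₂ : Fin (suc k) → V)
  (P₃ : Fin (suc l) → V) (P₄ : Fin (suc k) → V) → V → V → Set
SubEdge k l a ab ad c cb cd P₁ P₂ P₃ P₄ u v =
  TriEdge a ab ad u v ⊎ TriEdge c cb cd u v ⊎ PathEdge l P₁ u v
  ⊎ PathEdge k P₂ u v ⊎ PathEdge l P₃ u v ⊎ PathEdge k P₄ u v

corner4 : {V : Set} → V → V → V → V → Fin 4 → V
corner4 a b c d Fin.zero = a
corner4 a b c d (Fin.suc Fin.zero) = b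
corner4 a b c d (Fin.suc (Fin.suc Fin.zero)) = c
corner4 a b c d (Fin.suc (Fin.suc (Fin.suc Fin.zero))) = d

-- A Helly graph is an absolute retract: a partial map into it that does not increase distances
-- extends point by point, the image of a new point p being a common vertex of the pairwise
-- intersecting disks D(φ q, d∞(p, q)).  Extending the corner assignment A, B, C, D ↦ a, b, c, d
-- in this way gives a map φ from H₂^{k,l} into G that does not increase king distance d∞.
-- It is an isometry: every point p of H₂^{k,l} lies on a d∞-geodesic from A to C, so
-- d(a, c) = d∞(A, C) forces d(a, φ p) = d∞(A, p) = x + 1, and likewise d(b, φ p) = y + l for
-- p ≠ A, C; these two coordinates bound d(φ p, φ q) from below by d∞(p, q).  Finally H₂^{k,l}
-- itself realises d∞, by greedy King moves inside its diamond.

module Submission where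

open import Defs
open import Data.Nat using (ℕ; suc; _+_)
open import Data.Fin using (Fin)
open import Data.Product using (Σ; ∃; _×_; _,_)
open import Relation.Binary.PropositionalEquality using (_≡_)
open import Function.Bundles using (_⇔_)

open import Data.Nat as ℕ using (zero; _≤_; _∸_; _⊔_; z≤n; s≤s)
import Data.Nat.Properties as ℕP
open import Data.Integer as ℤ using (ℤ; +_; -[1+_]; -_; _-_; 0ℤ; 1ℤ; -1ℤ; ∣_∣; +≤+; -≤+; -≤-)
import Data.Integer.Properties as ℤP
open import Data.Integer.Tactic.RingSolver using (solve-∀)
open import Data.Product using (proj₁; proj₂)
open import Data.Product.Properties using (≡-dec)
open import Data.Sum using (_⊎_; inj₁; inj₂)
open import Data.Empty using (⊥-elim)
open import Data.List using (List; []; _∷_; cartesianProductWith; upTo)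
open import Data.List.Membership.Propositional using (_∈_)
open import Data.List.Membership.Propositional.Properties using (∈-cartesianProductWith⁺; ∈-upTo⁺)
open import Data.List.Relation.Unary.Any using (here; there)
open import Data.List.Relation.Binary.Subset.Propositional using (_⊆_)
open import Relation.Binary.Definitions using (Symmetric; DecidableEquality)
open import Relation.Binary.PropositionalEquality
  using (refl; sym; trans; cong; cong₂; subst; subst₂; module ≡-Reasoning)
open import Relation.Nullary using (¬_; yes; no)
open import Function.Bundles using (mk⇔)

Dist≥ : {V : Set} → (V → V → Set) → V → V → ℕ → Set
Dist≥ E u v r = ∀ m → Walk E u v m → r ≤ m

module _ {V : Set} {E : V → V → Set} where

  infixr 5 _++ʷ_
  _++ʷ_ : ∀ {u v w m n} → Walk E u v m → Walk E v w n → Walk E u w (m + n)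
  [] ++ʷ q = q
  (e ∷ p) ++ʷ q = e ∷ (p ++ʷ q)

  castʷ : ∀ {u v m n} → m ≡ n → Walk E u v m → Walk E u v n
  castʷ refl p = p

  reverseʷ : Symmetric E → ∀ {u v m} → Walk E u v m → Walk E v u m
  reverseʷ E-sym [] = []
  reverseʷ E-sym {m = suc m} (e ∷ p) = castʷ (ℕP.+-comm m 1) (reverseʷ E-sym p ++ʷ (E-sym e ∷ []))

  splitAtʷ : ∀ i {u v m} → Walk E u v (i + m) → ∃ λ z → Walk E u z i × Walk E z v m
  splitAtʷ zero p = _ , [] , p
  splitAtʷ (suc i) (e ∷ p) with splitAtʷ i p
  ... | z , p₁ , p₂ = z , e ∷ p₁ , p₂

  Walk-0⇒≡ : ∀ {u v} → Walk E u v 0 → u ≡ v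
  Walk-0⇒≡ [] = refl

  Walk-1⇒E : ∀ {u v} → Walk E u v 1 → E u v
  Walk-1⇒E (e ∷ []) = e

  InDisk-walk : ∀ {u v m} → Walk E u v m → InDisk E u m v
  InDisk-walk p = _ , ℕP.≤-refl , p

  InDisk-mono : ∀ {u v r r′} → r ≤ r′ → InDisk E u r v → InDisk E u r′ v
  InDisk-mono r≤r′ (m , m≤r , p) = m , ℕP.≤-trans m≤r r≤r′ , p

  InDisk-trans : ∀ {u v w i j} → InDisk E u i v → InDisk E v j w → InDisk E u (i + j) w
  InDisk-trans (m , m≤i , p) (n , n≤j , q) = m + n , ℕP.+-mono-≤ m≤i n≤j , p ++ʷ q

  InDisk-0⇒≡ : ∀ {u v} → InDisk E u 0 v → u ≡ v
  InDisk-0⇒≡ (zero , _ , p) = Walk-0⇒≡ p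

  InDisk-sym : Symmetric E → ∀ {u v r} → InDisk E u r v → InDisk E v r u
  InDisk-sym E-sym (m , m≤r , p) = m , m≤r , reverseʷ E-sym p

  InDisk-split : Symmetric E → ∀ {u w} i j → InDisk E u (i + j) w → ∃ λ z → InDisk E u i z × InDisk E w j z
  InDisk-split E-sym {w = w} i j (m , m≤i+j , p) with m ℕ.≤? i
  ... | yes m≤i = w , (m , m≤i , p) , (0 , z≤n , [])
  ... | no m≰i with splitAtʷ i (castʷ (sym (ℕP.m+[n∸m]≡n (ℕP.<⇒≤ (ℕP.≰⇒> m≰i)))) p)
  ...   | z , p₁ , p₂ = z , (i , ℕP.≤-refl , p₁) , (m ∸ i , ℕP.m≤n+o⇒m∸n≤o m i m≤i+j , reverseʷ E-sym p₂)

  Dist≥-sym : Symmetric E → ∀ {u v r} → Dist≥ E u v r → Dist≥ E v u r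
  Dist≥-sym E-sym lb m p = lb m (reverseʷ E-sym p)

  Dist≥-InDisk : ∀ {u v r i} → Dist≥ E u v r → InDisk E u i v → r ≤ i
  Dist≥-InDisk lb (m , m≤i , p) = ℕP.≤-trans (lb m p) m≤i

  Dist≥-interval : ∀ {u v w r j} → Dist≥ E u w (r + j) → InDisk E v j w → Dist≥ E u v r
  Dist≥-interval {j = j} lb v-w m p =
    ℕP.+-cancelʳ-≤ j _ m (Dist≥-InDisk lb (InDisk-trans (InDisk-walk p) v-w))

  Dist≥-Lipschitz : ∀ {u v w i j m} → InDisk E u i v → Dist≥ E u w j → Walk E v w m → j ≤ i + m
  Dist≥-Lipschitz u-v lb p = Dist≥-InDisk lb (InDisk-trans u-v (InDisk-walk p))

  InDisk∧Dist≥⇒Dist : ∀ {u v r} → InDisk E u r v → Dist≥ E u v r → Dist E u v r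
  InDisk∧Dist≥⇒Dist (m , m≤r , p) lb = castʷ (ℕP.≤-antisym m≤r (lb m p)) p , lb

  Dist-unique : ∀ {u v m n} → Dist E u v m → Dist E u v n → m ≡ n
  Dist-unique (p , lb) (q , lb′) = ℕP.≤-antisym (lb _ q) (lb′ _ p)

  Dist-refl⇒0 : ∀ {u m} → Dist E u u m → m ≡ 0
  Dist-refl⇒0 (_ , lb) = ℕP.n≤0⇒n≡0 (lb 0 [])

  E⇒Dist-1 : (∀ {u} → ¬ E u u) → ∀ {u v m} → E u v → Dist E u v m → m ≡ 1
  E⇒Dist-1 irrefl {m = zero} e (p , _) = ⊥-elim (irrefl (subst (E _) (sym (Walk-0⇒≡ p)) e))
  E⇒Dist-1 irrefl {m = suc zero} e _ = refl
  E⇒Dist-1 irrefl {m = suc (suc _)} e (_ , lb) with lb 1 (e ∷ [])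
  ... | s≤s ()

Dist-⇔ : ∀ {V W : Set} {E : V → V → Set} {E′ : W → W → Set} {u v u′ v′ r} →
  Dist E u v r → Dist E′ u′ v′ r → ∀ m → Dist E u v m ⇔ Dist E′ u′ v′ m
Dist-⇔ {E = E} {E′} {u} {v} {u′} {v′} d d′ m = mk⇔
  (λ dm → subst (Dist E′ u′ v′) (Dist-unique d dm) d′)
  (λ dm → subst (Dist E u v) (Dist-unique d′ dm) d)

module HellyExtension {V X : Set} {E : V → V → Set} (E-sym : Symmetric E) (helly : Helly E)
  (_≟_ : DecidableEquality X) (δ : X → X → ℕ) (δ-refl : ∀ p → δ p p ≡ 0)
  (δ-sym : ∀ p q → δ p q ≡ δ q p) (δ-triangle : ∀ p q r → δ p r ≤ δ p q + δ q r) where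

  open import Data.List.Membership.DecPropositional _≟_ using (_∈?_)

  NonExpanding : List (X × V) → Set
  NonExpanding L = ∀ {p v q w} → (p , v) ∈ L → (q , w) ∈ L → InDisk E v (δ p q) w

  Compatible : List (X × V) → X → V → Set
  Compatible L p v = ∀ {q w} → (q , w) ∈ L → InDisk E v (δ p q) w

  ∷-nonExpanding : ∀ {L p v} → NonExpanding L → Compatible L p v → NonExpanding ((p , v) ∷ L)
  ∷-nonExpanding f g (here refl) (here refl) = 0 , z≤n , []
  ∷-nonExpanding f g (here refl) (there j) = g j
  ∷-nonExpanding {p = p} f g {p = q} (there i) (here refl) =
    InDisk-sym E-sym (InDisk-mono (ℕP.≤-reflexive (δ-sym p q)) (g i))
  ∷-nonExpanding f g (there i) (there j) = f i j

  compatible-exists : ∀ {L} → NonExpanding L → ∀ p → ∃ (Compatible L p)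
  compatible-exists {L} f p
    with helly (Σ (X × V) (_∈ L)) (λ e → proj₂ (proj₁ e)) (λ e → δ (proj₁ (proj₁ e)) p) pairwise
    where
    -- The disks D(w, δ q p) meet pairwise because d(w, w′) ≤ δ q q′ ≤ δ q p + δ q′ p.
    pairwise : ∀ (e e′ : Σ (X × V) (_∈ L)) → ∃ λ z →
      InDisk E (proj₂ (proj₁ e)) (δ (proj₁ (proj₁ e)) p) z × InDisk E (proj₂ (proj₁ e′)) (δ (proj₁ (proj₁ e′)) p) z
    pairwise ((q , w) , i) ((q′ , w′) , j) =
      InDisk-split E-sym (δ q p) (δ q′ p)
        (InDisk-mono (subst (λ r → δ q q′ ≤ δ q p + r) (δ-sym p q′) (δ-triangle q p q′)) (f i j))
  ... | v , common = v , λ {q} i → InDisk-mono (ℕP.≤-reflexive (δ-sym q p)) (InDisk-sym E-sym (common (_ , i)))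

  record Extension (L : List (X × V)) (ps : List X) : Set where
    field
      entries : List (X × V)
      nonExpanding : NonExpanding entries
      initial⊆ : L ⊆ entries
      covers : ∀ {p} → p ∈ ps → ∃ λ v → (p , v) ∈ entries

  extend : ∀ {L} → NonExpanding L → (ps : List X) → Extension L ps
  extend {L} f [] = record { entries = L ; nonExpanding = f ; initial⊆ = λ i → i ; covers = λ () }
  extend {L} f (p ∷ ps) = record
    { entries = entries ; nonExpanding = nonExpanding ; initial⊆ = λ i → initial⊆ (there i) ; covers = covers′ }
    where
    placed = compatible-exists f p
    open Extension (extend (∷-nonExpanding f (proj₂ placed)) ps)
    covers′ : ∀ {q} → q ∈ p ∷ ps → ∃ λ v → (q , v) ∈ entries
    covers′ (here refl) = proj₁ placed , initial⊆ (here refl)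
    covers′ (there i) = covers i

  record NonExpandingExtension (L : List (X × V)) (ps : List X) : Set where
    field
      map : X → V
      nonExpanding-map : ∀ {p q} → p ∈ ps → q ∈ ps → InDisk E (map p) (δ p q) (map q)
      agrees : ∀ {p v} → (p , v) ∈ L → p ∈ ps → map p ≡ v

  nonExpanding-extension : ∀ {L} → NonExpanding L → (ps : List X) → V → NonExpandingExtension L ps
  nonExpanding-extension {L} f ps v₀ = record
    { map = φ ; nonExpanding-map = λ i j → nonExpanding (entry i) (entry j) ; agrees = agrees }
    where
    open Extension (extend f ps)
    φ : X → V
    φ p with p ∈? ps
    ... | yes i = proj₁ (covers i)
    ... | no _ = v₀
    entry : ∀ {p} → p ∈ ps → (p , φ p) ∈ entries
    entry {p} i with p ∈? ps
    ... | yes i′ = proj₂ (covers i′)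
    ... | no p∉ps = ⊥-elim (p∉ps i)
    agrees : ∀ {p v} → (p , v) ∈ L → p ∈ ps → φ p ≡ v
    agrees {p} e i = sym (InDisk-0⇒≡ (InDisk-mono (ℕP.≤-reflexive (δ-refl p)) (nonExpanding (initial⊆ e) (entry i))))

kingDist : Point → Point → ℕ
kingDist (x , y) (x′ , y′) = ∣ x - x′ ∣ ⊔ ∣ y - y′ ∣

_≟ₚ_ : DecidableEquality Point
_≟ₚ_ = ≡-dec ℤ._≟_ ℤ._≟_

kingDist-sym : ∀ p q → kingDist p q ≡ kingDist q p
kingDist-sym (x , y) (x′ , y′) = cong₂ _⊔_ (ℤP.∣i-j∣≡∣j-i∣ x x′) (ℤP.∣i-j∣≡∣j-i∣ y y′)

kingDist-refl : ∀ p → kingDist p p ≡ 0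
kingDist-refl (x , y) = cong₂ _⊔_ (cong ∣_∣ (ℤP.+-inverseʳ x)) (cong ∣_∣ (ℤP.+-inverseʳ y))

kingDist≡0⇒≡ : ∀ {p q} → kingDist p q ≡ 0 → p ≡ q
kingDist≡0⇒≡ {x , y} {x′ , y′} eq = cong₂ _,_ (coordinate (ℕP.m≤m⊔n _ _)) (coordinate (ℕP.m≤n⊔m _ _))
  where
  coordinate : ∀ {i j} → ∣ i - j ∣ ≤ kingDist (x , y) (x′ , y′) → i ≡ j
  coordinate {i} {j} le = ℤP.i-j≡0⇒i≡j i j (ℤP.∣i∣≡0⇒i≡0 (ℕP.n≤0⇒n≡0 (ℕP.≤-trans le (ℕP.≤-reflexive eq))))

∣i-k∣≤∣i-j∣+∣j-k∣ : ∀ i j k → ∣ i - k ∣ ≤ ∣ i - j ∣ + ∣ j - k ∣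
∣i-k∣≤∣i-j∣+∣j-k∣ i j k =
  subst (λ e → ∣ e ∣ ≤ ∣ i - j ∣ + ∣ j - k ∣) (telescope i j k) (ℤP.∣i+j∣≤∣i∣+∣j∣ (i - j) (j - k))
  where
  telescope : ∀ i j k → (i - j) ℤ.+ (j - k) ≡ i - k
  telescope = solve-∀

kingDist-triangle : ∀ p q r → kingDist p r ≤ kingDist p q + kingDist q r
kingDist-triangle (x , y) (x′ , y′) (x″ , y″) = ℕP.⊔-lub
  (ℕP.≤-trans (∣i-k∣≤∣i-j∣+∣j-k∣ x x′ x″)
    (ℕP.+-mono-≤ (ℕP.m≤m⊔n ∣ x - x′ ∣ ∣ y - y′ ∣) (ℕP.m≤m⊔n ∣ x′ - x″ ∣ ∣ y′ - y″ ∣)))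
  (ℕP.≤-trans (∣i-k∣≤∣i-j∣+∣j-k∣ y y′ y″)
    (ℕP.+-mono-≤ (ℕP.m≤n⊔m ∣ x - x′ ∣ ∣ y - y′ ∣) (ℕP.m≤n⊔m ∣ x′ - x″ ∣ ∣ y′ - y″ ∣)))

kingDist≤length : ∀ {E′ : Point → Point → Set} → (∀ {u v} → E′ u v → King u v) →
  ∀ {p q m} → Walk E′ p q m → kingDist p q ≤ m
kingDist≤length king {p} [] = ℕP.≤-reflexive (kingDist-refl p)
kingDist≤length king {p} {q} (_∷_ {w = r} e walk) = ℕP.≤-trans (kingDist-triangle p r q)
  (subst (λ d → d + kingDist r q ≤ suc _) (sym (king e)) (s≤s (kingDist≤length king walk)))

≤-by-difference : ∀ {i j k l} → i ℤ.≤ j → j - i ≡ l - k → k ℤ.≤ l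
≤-by-difference i≤j eq = ℤP.0≤i-j⇒j≤i (subst (0ℤ ℤ.≤_) eq (ℤP.i≤j⇒0≤j-i i≤j))

≤-by-sum : ∀ {i j i′ j′ k l} → i ℤ.≤ j → i′ ℤ.≤ j′ → (j - i) ℤ.+ (j′ - i′) ≡ l - k → k ℤ.≤ l
≤-by-sum i≤j i′≤j′ eq =
  ℤP.0≤i-j⇒j≤i (subst (0ℤ ℤ.≤_) eq (ℤP.+-mono-≤ (ℤP.i≤j⇒0≤j-i i≤j) (ℤP.i≤j⇒0≤j-i i′≤j′)))

+∣i∣≤j : ∀ {i j} → i ℤ.≤ j → - i ℤ.≤ j → + ∣ i ∣ ℤ.≤ j
+∣i∣≤j {i} i≤j -i≤j with ℤP.+∣i∣≡i⊎+∣i∣≡-i i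
... | inj₁ eq = subst (ℤ._≤ _) (sym eq) i≤j
... | inj₂ eq = subst (ℤ._≤ _) (sym eq) -i≤j

∣i∣⊔∣j∣-dominant : ∀ {i j} → j ℤ.≤ i → - j ℤ.≤ i → + (∣ i ∣ ⊔ ∣ j ∣) ≡ i
∣i∣⊔∣j∣-dominant {i} {j} j≤i -j≤i = trans (cong +_ (ℕP.m≥n⇒m⊔n≡m ∣j∣≤∣i∣)) (ℤP.0≤i⇒+∣i∣≡i 0≤i)
  where
  +∣j∣≤i = +∣i∣≤j j≤i -j≤i
  0≤i = ℤP.≤-trans (+≤+ z≤n) +∣j∣≤i
  ∣j∣≤∣i∣ = ℤP.drop‿+≤+ (subst (+ ∣ j ∣ ℤ.≤_) (sym (ℤP.0≤i⇒+∣i∣≡i 0≤i)) +∣j∣≤i)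

+m-+n≤+o : ∀ {m n o} → m ≤ n + o → + m - + n ℤ.≤ + o
+m-+n≤+o {m} {n} {o} m≤n+o = ≤-by-difference (+≤+ m≤n+o)
  (trans (cong (_- + m) (ℤP.pos-+ n o)) (shuffle (+ m) (+ n) (+ o)))
  where
  shuffle : ∀ m n o → n ℤ.+ o - m ≡ o - (m - n)
  shuffle = solve-∀

∣a-b∣≤-offsets : ∀ {i j m} {a b o : ℤ} → + i ≡ a - o → + j ≡ b - o → i ≤ j + m × j ≤ i + m → ∣ a - b ∣ ≤ m
∣a-b∣≤-offsets {i} {j} {m} {a} {b} {o} ei ej (i≤j+m , j≤i+m) = ℤP.drop‿+≤+ (+∣i∣≤j
  (subst (ℤ._≤ + m) (trans (cong₂ _-_ ei ej) (cancel a b o)) (+m-+n≤+o i≤j+m))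
  (subst (ℤ._≤ + m) (trans (cong₂ _-_ ej ei) (cancel-neg a b o)) (+m-+n≤+o j≤i+m)))
  where
  cancel : ∀ a b o → (a - o) - (b - o) ≡ a - b
  cancel = solve-∀
  cancel-neg : ∀ a b o → (b - o) - (a - o) ≡ - (a - b)
  cancel-neg = solve-∀

-- Quarter planes in which the horizontal (resp. vertical) displacement realises the king distance.
record _≼ₓ_ (p q : Point) : Set where
  constructor _,_
  field
    s≤ : s p ℤ.≤ s q
    t≤ : t p ℤ.≤ t q

record _≼ᵧ_ (p q : Point) : Set where
  constructor _,_
  field
    s≤ : s p ℤ.≤ s q
    t≥ : t q ℤ.≤ t p

≼ₓ-trans : ∀ {p q r} → p ≼ₓ q → q ≼ₓ r → p ≼ₓ r
≼ₓ-trans (s₁ , t₁) (s₂ , t₂) = ℤP.≤-trans s₁ s₂ , ℤP.≤-trans t₁ t₂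

≼ᵧ-trans : ∀ {p q r} → p ≼ᵧ q → q ≼ᵧ r → p ≼ᵧ r
≼ᵧ-trans (s₁ , t₁) (s₂ , t₂) = ℤP.≤-trans s₁ s₂ , ℤP.≤-trans t₂ t₁

≼ₓ⇒kingDist : ∀ {p q} → p ≼ₓ q → + kingDist p q ≡ proj₁ q - proj₁ p
≼ₓ⇒kingDist {x , y} {x′ , y′} (s≤ , t≤) = trans (cong +_ (kingDist-sym (x , y) (x′ , y′)))
  (∣i∣⊔∣j∣-dominant (≤-by-difference t≤ (Δt x y x′ y′)) (≤-by-difference s≤ (Δs x y x′ y′)))
  where
  Δt : ∀ x y x′ y′ → (x′ - y′) - (x - y) ≡ (x′ - x) - (y′ - y)
  Δt = solve-∀
  Δs : ∀ x y x′ y′ → (x′ ℤ.+ y′) - (x ℤ.+ y) ≡ (x′ - x) - - (y′ - y)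
  Δs = solve-∀

≼ᵧ⇒kingDist : ∀ {p q} → p ≼ᵧ q → + kingDist p q ≡ proj₂ q - proj₂ p
≼ᵧ⇒kingDist {x , y} {x′ , y′} (s≤ , t≥) =
  trans (cong +_ (trans (kingDist-sym (x , y) (x′ , y′)) (ℕP.⊔-comm ∣ x′ - x ∣ ∣ y′ - y ∣)))
    (∣i∣⊔∣j∣-dominant (≤-by-difference t≥ (Δt x y x′ y′)) (≤-by-difference s≤ (Δs x y x′ y′)))
  where
  Δt : ∀ x y x′ y′ → (x - y) - (x′ - y′) ≡ (y′ - y) - (x′ - x)
  Δt = solve-∀
  Δs : ∀ x y x′ y′ → (x′ ℤ.+ y′) - (x ℤ.+ y) ≡ (y′ - y) - - (x′ - x)
  Δs = solve-∀

differences-add : ∀ {a b c} (u v w : ℤ) → + a ≡ v - u → + b ≡ w - v → + c ≡ w - u → a + b ≡ c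
differences-add {a} {b} {c} u v w ea eb ec = ℤP.+-injective (begin
  + (a + b)            ≡⟨ ℤP.pos-+ a b ⟩
  + a ℤ.+ + b          ≡⟨ cong₂ ℤ._+_ ea eb ⟩
  (v - u) ℤ.+ (w - v)  ≡⟨ telescope u v w ⟩
  w - u                ≡⟨ ec ⟨
  + c                  ∎)
  where
  open ≡-Reasoning
  telescope : ∀ u v w → (v - u) ℤ.+ (w - v) ≡ w - u
  telescope = solve-∀

kingDist-≼ₓ-+ : ∀ {p q r} → p ≼ₓ q → q ≼ₓ r → kingDist p q + kingDist q r ≡ kingDist p r
kingDist-≼ₓ-+ {p} {q} {r} pq qr = differences-add (proj₁ p) (proj₁ q) (proj₁ r)
  (≼ₓ⇒kingDist pq) (≼ₓ⇒kingDist qr) (≼ₓ⇒kingDist (≼ₓ-trans pq qr))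

kingDist-≼ᵧ-+ : ∀ {p q r} → p ≼ᵧ q → q ≼ᵧ r → kingDist p q + kingDist q r ≡ kingDist p r
kingDist-≼ᵧ-+ {p} {q} {r} pq qr = differences-add (proj₂ p) (proj₂ q) (proj₂ r)
  (≼ᵧ⇒kingDist pq) (≼ᵧ⇒kingDist qr) (≼ᵧ⇒kingDist (≼ᵧ-trans pq qr))

signum : ℤ → ℤ
signum (+ zero) = 0ℤ
signum (+ suc _) = 1ℤ
signum -[1+ _ ] = -1ℤ

signum-neg : ∀ i → signum (- i) ≡ - signum i
signum-neg (+ zero) = refl
signum-neg (+ suc _) = refl
signum-neg -[1+ _ ] = refl

∣signum∣ : ∀ i → ∣ signum i ∣ ≡ 1 ℕ.⊓ ∣ i ∣
∣signum∣ (+ zero) = refl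
∣signum∣ (+ suc _) = refl
∣signum∣ -[1+ _ ] = refl

∣i-signum[i]∣ : ∀ i → ∣ i - signum i ∣ ≡ ∣ i ∣ ∸ 1
∣i-signum[i]∣ (+ zero) = refl
∣i-signum[i]∣ (+ suc _) = refl
∣i-signum[i]∣ -[1+ zero ] = refl
∣i-signum[i]∣ -[1+ suc _ ] = refl

stepToward : Point → Point → Point
stepToward (x , y) (x′ , y′) = x ℤ.+ signum (x′ - x) , y ℤ.+ signum (y′ - y)

kingDist-stepToward : ∀ {p q n} → kingDist p q ≡ suc n → kingDist (stepToward p q) q ≡ n
kingDist-stepToward {x , y} {x′ , y′} {n} eq = begin
  ∣ x ℤ.+ signum (x′ - x) - x′ ∣ ⊔ ∣ y ℤ.+ signum (y′ - y) - y′ ∣ ≡⟨ cong₂ _⊔_ (remaining x x′) (remaining y y′) ⟩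
  (∣ x′ - x ∣ ∸ 1) ⊔ (∣ y′ - y ∣ ∸ 1)                             ≡⟨ ℕP.∸-distribʳ-⊔ 1 ∣ x′ - x ∣ ∣ y′ - y ∣ ⟨
  (∣ x′ - x ∣ ⊔ ∣ y′ - y ∣) ∸ 1                                   ≡⟨ cong (_∸ 1) kingDist-qp ⟩
  n                                                               ∎
  where
  open ≡-Reasoning
  kingDist-qp : ∣ x′ - x ∣ ⊔ ∣ y′ - y ∣ ≡ suc n
  kingDist-qp = trans (kingDist-sym (x′ , y′) (x , y)) eq
  shift : ∀ x x′ g → x ℤ.+ g - x′ ≡ - ((x′ - x) - g)
  shift = solve-∀
  remaining : ∀ x x′ → ∣ x ℤ.+ signum (x′ - x) - x′ ∣ ≡ ∣ x′ - x ∣ ∸ 1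
  remaining x x′ = trans (cong ∣_∣ (shift x x′ (signum (x′ - x))))
    (trans (ℤP.∣-i∣≡∣i∣ (x′ - x - signum (x′ - x))) (∣i-signum[i]∣ (x′ - x)))

stepToward-king : ∀ {p q n} → kingDist p q ≡ suc n → King p (stepToward p q)
stepToward-king {x , y} {x′ , y′} {n} eq = begin
  ∣ x - (x ℤ.+ signum (x′ - x)) ∣ ⊔ ∣ y - (y ℤ.+ signum (y′ - y)) ∣ ≡⟨ cong₂ _⊔_ (move x x′) (move y y′) ⟩
  (1 ℕ.⊓ ∣ x′ - x ∣) ⊔ (1 ℕ.⊓ ∣ y′ - y ∣)                         ≡⟨ ℕP.⊓-distribˡ-⊔ 1 ∣ x′ - x ∣ ∣ y′ - y ∣ ⟨
  1 ℕ.⊓ (∣ x′ - x ∣ ⊔ ∣ y′ - y ∣)                                 ≡⟨ cong (1 ℕ.⊓_) kingDist-qp ⟩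
  1                                                               ∎
  where
  open ≡-Reasoning
  kingDist-qp : ∣ x′ - x ∣ ⊔ ∣ y′ - y ∣ ≡ suc n
  kingDist-qp = trans (kingDist-sym (x′ , y′) (x , y)) eq
  back : ∀ x g → x - (x ℤ.+ g) ≡ - g
  back = solve-∀
  move : ∀ x x′ → ∣ x - (x ℤ.+ signum (x′ - x)) ∣ ≡ 1 ℕ.⊓ ∣ x′ - x ∣
  move x x′ = trans (cong ∣_∣ (back x (signum (x′ - x)))) (trans (ℤP.∣-i∣≡∣i∣ (signum (x′ - x))) (∣signum∣ (x′ - x)))

Between : ℤ → ℤ → Set
Between w z = (0ℤ ℤ.≤ w × w ℤ.≤ z) ⊎ (z ℤ.≤ w × w ℤ.≤ 0ℤ)

signum+signum-between : ∀ i j → Between (signum i ℤ.+ signum j) (i ℤ.+ j)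
signum+signum-between (+ zero) (+ zero) = inj₁ (ℤP.≤-refl , ℤP.≤-refl)
signum+signum-between (+ zero) (+ suc _) = inj₁ (+≤+ z≤n , +≤+ (s≤s z≤n))
signum+signum-between (+ zero) -[1+ _ ] = inj₂ (-≤- z≤n , -≤+)
signum+signum-between (+ suc _) (+ zero) = inj₁ (+≤+ z≤n , +≤+ (s≤s z≤n))
signum+signum-between (+ suc i) (+ suc j) = inj₁ (+≤+ z≤n , +≤+ (s≤s (ℕP.≤-trans (s≤s z≤n) (ℕP.m≤n+m (suc j) i))))
signum+signum-between (+ suc i) -[1+ j ] with ℤP.≤-total 0ℤ (+ suc i ℤ.+ -[1+ j ])
... | inj₁ 0≤ = inj₁ (ℤP.≤-refl , 0≤)
... | inj₂ ≤0 = inj₂ (≤0 , ℤP.≤-refl)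
signum+signum-between -[1+ _ ] (+ zero) = inj₂ (-≤- z≤n , -≤+)
signum+signum-between -[1+ i ] (+ suc j) with ℤP.≤-total 0ℤ (-[1+ i ] ℤ.+ + suc j)
... | inj₁ 0≤ = inj₁ (ℤP.≤-refl , 0≤)
... | inj₂ ≤0 = inj₂ (≤0 , ℤP.≤-refl)
signum+signum-between -[1+ _ ] -[1+ _ ] = inj₂ (-≤- (s≤s z≤n) , -≤+)

+-between-interval : ∀ {lo hi a z w} → lo ℤ.≤ a → a ℤ.≤ hi → lo ℤ.≤ a ℤ.+ z → a ℤ.+ z ℤ.≤ hi →
  Between w z → lo ℤ.≤ a ℤ.+ w × a ℤ.+ w ℤ.≤ hi
+-between-interval {a = a} lo≤a a≤hi lo≤a+z a+z≤hi (inj₁ (0≤w , w≤z)) =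
  ℤP.≤-trans lo≤a (subst (ℤ._≤ a ℤ.+ _) (ℤP.+-identityʳ a) (ℤP.+-monoʳ-≤ a 0≤w)) ,
  ℤP.≤-trans (ℤP.+-monoʳ-≤ a w≤z) a+z≤hi
+-between-interval {a = a} lo≤a a≤hi lo≤a+z a+z≤hi (inj₂ (z≤w , w≤0)) =
  ℤP.≤-trans lo≤a+z (ℤP.+-monoʳ-≤ a z≤w) ,
  ℤP.≤-trans (subst (a ℤ.+ _ ℤ.≤_) (ℤP.+-identityʳ a) (ℤP.+-monoʳ-≤ a w≤0)) a≤hi

Diamond : ℤ → ℤ → ℤ → ℤ → Point → Set
Diamond s₀ s₁ t₀ t₁ u = s₀ ℤ.≤ s u × s u ℤ.≤ s₁ × t₀ ℤ.≤ t u × t u ℤ.≤ t₁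

stepToward-Diamond : ∀ {s₀ s₁ t₀ t₁ p q} → Diamond s₀ s₁ t₀ t₁ p → Diamond s₀ s₁ t₀ t₁ q →
  Diamond s₀ s₁ t₀ t₁ (stepToward p q)
stepToward-Diamond {s₀} {s₁} {t₀} {t₁} {x , y} {x′ , y′} (s₀≤ , ≤s₁ , t₀≤ , ≤t₁) (s₀≤′ , ≤s₁′ , t₀≤′ , ≤t₁′) =
  proj₁ along-s , proj₂ along-s , proj₁ along-t , proj₂ along-t
  where
  Δs : ∀ x y x′ y′ → x′ ℤ.+ y′ ≡ (x ℤ.+ y) ℤ.+ ((x′ - x) ℤ.+ (y′ - y))
  Δs = solve-∀
  Δt : ∀ x y x′ y′ → x′ - y′ ≡ (x - y) ℤ.+ ((x′ - x) ℤ.+ - (y′ - y))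
  Δt = solve-∀
  regroup-s : ∀ x y g h → (x ℤ.+ y) ℤ.+ (g ℤ.+ h) ≡ (x ℤ.+ g) ℤ.+ (y ℤ.+ h)
  regroup-s = solve-∀
  regroup-t : ∀ x y g h → (x - y) ℤ.+ (g ℤ.+ - h) ≡ (x ℤ.+ g) - (y ℤ.+ h)
  regroup-t = solve-∀
  g = signum (x′ - x)
  h = signum (y′ - y)
  along-s : s₀ ℤ.≤ (x ℤ.+ g) ℤ.+ (y ℤ.+ h) × (x ℤ.+ g) ℤ.+ (y ℤ.+ h) ℤ.≤ s₁
  along-s = subst (λ e → s₀ ℤ.≤ e × e ℤ.≤ s₁) (regroup-s x y g h)
    (+-between-interval s₀≤ ≤s₁ (subst (s₀ ℤ.≤_) (Δs x y x′ y′) s₀≤′) (subst (ℤ._≤ s₁) (Δs x y x′ y′) ≤s₁′)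
      (signum+signum-between (x′ - x) (y′ - y)))
  along-t : t₀ ℤ.≤ (x ℤ.+ g) - (y ℤ.+ h) × (x ℤ.+ g) - (y ℤ.+ h) ℤ.≤ t₁
  along-t = subst (λ e → t₀ ℤ.≤ e × e ℤ.≤ t₁)
    (trans (cong (λ h⁻ → (x - y) ℤ.+ (g ℤ.+ h⁻)) (signum-neg (y′ - y))) (regroup-t x y g h))
    (+-between-interval t₀≤ ≤t₁ (subst (t₀ ℤ.≤_) (Δt x y x′ y′) t₀≤′) (subst (ℤ._≤ t₁) (Δt x y x′ y′) ≤t₁′)
      (signum+signum-between (x′ - x) (- (y′ - y))))

module _ {s₀ s₁ t₀ t₁ : ℤ} {E′ : Point → Point → Set}
  (edge : ∀ {u v} → Diamond s₀ s₁ t₀ t₁ u → Diamond s₀ s₁ t₀ t₁ v → King u v → E′ u v) where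

  greedyWalk : ∀ {p q} → Diamond s₀ s₁ t₀ t₁ p → Diamond s₀ s₁ t₀ t₁ q → Walk E′ p q (kingDist p q)
  greedyWalk = walk _ refl
    where
    walk : ∀ n {p q} → kingDist p q ≡ n → Diamond s₀ s₁ t₀ t₁ p → Diamond s₀ s₁ t₀ t₁ q → Walk E′ p q n
    walk zero {p} eq _ _ = subst (λ r → Walk E′ p r 0) (kingDist≡0⇒≡ eq) []
    walk (suc n) {p} {q} eq dp dq =
      edge {p} dp dstep (stepToward-king {p} {q} eq) ∷ walk n (kingDist-stepToward {p} {q} eq) dstep dq
      where
      dstep = stepToward-Diamond {p = p} {q} dp dq

0≤1+2i⇒0≤2i : ∀ i → 0ℤ ℤ.≤ 1ℤ ℤ.+ (i ℤ.+ i) → 0ℤ ℤ.≤ i ℤ.+ i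
0≤1+2i⇒0≤2i (+ _) _ = +≤+ z≤n
0≤1+2i⇒0≤2i -[1+ _ ] ()

+[2n] : ∀ n → + (2 ℕ.* n) ≡ + n ℤ.+ + n
+[2n] n = trans (ℤP.pos-+ n (n ℕ.+ 0)) (cong (λ m → + n ℤ.+ + m) (ℕP.+-identityʳ n))

module Geometry (k l : ℕ) where

  A B C D : Point
  A = cornerA k l
  B = cornerB k l
  C = cornerC k l
  D = cornerD k l

  Main : Point → Set
  Main = Diamond 0ℤ (+ (2 ℕ.* k ℕ.+ 1)) -1ℤ (+ (2 ℕ.* l))

  inA : InH k l A
  inA = inj₂ (inj₁ refl)

  inC : InH k l C
  inC = inj₂ (inj₂ refl)

  K L : ℤ
  K = + k
  L = + l

  +[2k+1] : + (2 ℕ.* k ℕ.+ 1) ≡ K ℤ.+ K ℤ.+ 1ℤ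
  +[2k+1] = trans (ℤP.pos-+ (2 ℕ.* k) 1) (cong (ℤ._+ 1ℤ) (+[2n] k))

  +[k+l+1] : + (k ℕ.+ l ℕ.+ 1) ≡ K ℤ.+ L ℤ.+ 1ℤ
  +[k+l+1] = trans (ℤP.pos-+ (k ℕ.+ l) 1) (cong (ℤ._+ 1ℤ) (ℤP.pos-+ k l))

  s-B : s B ≡ 0ℤ
  s-B = ℤP.+-inverseʳ L

  t-B : t B ≡ + (2 ℕ.* l)
  t-B = trans (cong (ℤ._+_ L) (ℤP.neg-involutive L)) (sym (+[2n] l))

  s-D : s D ≡ + (2 ℕ.* k ℕ.+ 1)
  s-D = trans (cong (ℤ._+_ K) (ℤP.pos-+ 1 k)) (trans (shuffle K) (sym +[2k+1]))
    where
    shuffle : ∀ K → K ℤ.+ (1ℤ ℤ.+ K) ≡ K ℤ.+ K ℤ.+ 1ℤ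
    shuffle = solve-∀

  t-D : t D ≡ -1ℤ
  t-D = trans (cong (λ y → K - y) (ℤP.pos-+ 1 k)) (cancel K)
    where
    cancel : ∀ K → K - (1ℤ ℤ.+ K) ≡ -1ℤ
    cancel = solve-∀

  s-C : s C ≡ + (2 ℕ.* k ℕ.+ 1) ℤ.+ 1ℤ
  s-C = trans (cong (ℤ._+ (K - L ℤ.+ 1ℤ)) +[k+l+1]) (trans (shuffle K L) (cong (ℤ._+ 1ℤ) (sym +[2k+1])))
    where
    shuffle : ∀ K L → (K ℤ.+ L ℤ.+ 1ℤ) ℤ.+ (K - L ℤ.+ 1ℤ) ≡ K ℤ.+ K ℤ.+ 1ℤ ℤ.+ 1ℤ
    shuffle = solve-∀

  t-C : t C ≡ + (2 ℕ.* l)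
  t-C = trans (cong (_- (K - L ℤ.+ 1ℤ)) +[k+l+1]) (trans (shuffle K L) (sym (+[2n] l)))
    where
    shuffle : ∀ K L → (K ℤ.+ L ℤ.+ 1ℤ) - (K - L ℤ.+ 1ℤ) ≡ L ℤ.+ L
    shuffle = solve-∀

  Main-B : Main B
  Main-B = subst (0ℤ ℤ.≤_) (sym s-B) ℤP.≤-refl , subst (ℤ._≤ + (2 ℕ.* k ℕ.+ 1)) (sym s-B) (+≤+ z≤n) ,
           subst (-1ℤ ℤ.≤_) (sym t-B) -≤+ , subst (ℤ._≤ + (2 ℕ.* l)) (sym t-B) ℤP.≤-refl

  Main-D : Main D
  Main-D = subst (0ℤ ℤ.≤_) (sym s-D) (+≤+ z≤n) , subst (ℤ._≤ + (2 ℕ.* k ℕ.+ 1)) (sym s-D) ℤP.≤-refl ,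
           subst (-1ℤ ℤ.≤_) (sym t-D) ℤP.≤-refl , subst (ℤ._≤ + (2 ℕ.* l)) (sym t-D) -≤+

  Main⇒A≼ₓ : ∀ {p} → Main p → A ≼ₓ p
  Main⇒A≼ₓ (0≤s , _ , -1≤t , _) = ℤP.≤-trans -≤+ 0≤s , -1≤t

  Main⇒≼ₓC : ∀ {p} → Main p → p ≼ₓ C
  Main⇒≼ₓC {p} (_ , s≤ , _ , t≤) =
    ℤP.≤-trans s≤ (subst (+ (2 ℕ.* k ℕ.+ 1) ℤ.≤_) (sym s-C) (ℤP.i≤i+j _ 1ℤ)) , subst (t p ℤ.≤_) (sym t-C) t≤

  Main⇒B≼ᵧ : ∀ {p} → Main p → B ≼ᵧ p
  Main⇒B≼ᵧ {p} (0≤s , _ , _ , t≤) = subst (ℤ._≤ s p) (sym s-B) 0≤s , subst (t p ℤ.≤_) (sym t-B) t≤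

  Main⇒≼ᵧD : ∀ {p} → Main p → p ≼ᵧ D
  Main⇒≼ᵧD {p} (_ , s≤ , -1≤t , _) = subst (s p ℤ.≤_) (sym s-D) s≤ , subst (ℤ._≤ t p) (sym t-D) -1≤t

  interval-AC : ∀ {p} → InH k l p → kingDist A p + kingDist p C ≡ kingDist A C
  interval-AC {p} (inj₁ mp) = kingDist-≼ₓ-+ (Main⇒A≼ₓ {p} mp) (Main⇒≼ₓC {p} mp)
  interval-AC (inj₂ (inj₁ refl)) = cong (_+ kingDist A C) (kingDist-refl A)
  interval-AC (inj₂ (inj₂ refl)) = trans (cong (_+_ (kingDist A C)) (kingDist-refl C)) (ℕP.+-identityʳ _)

  interval-BD : ∀ {p} → Main p → kingDist B p + kingDist p D ≡ kingDist B D
  interval-BD {p} mp = kingDist-≼ᵧ-+ (Main⇒B≼ᵧ {p} mp) (Main⇒≼ᵧD {p} mp)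

  kingDist-AB : kingDist A B ≡ l + 1
  kingDist-AB = ℤP.+-injective (trans (≼ₓ⇒kingDist (Main⇒A≼ₓ {B} Main-B)) (sym (ℤP.pos-+ l 1)))

  kingDist-AD : kingDist A D ≡ k + 1
  kingDist-AD = ℤP.+-injective (trans (≼ₓ⇒kingDist (Main⇒A≼ₓ {D} Main-D)) (sym (ℤP.pos-+ k 1)))

  kingDist-BC : kingDist B C ≡ k + 1
  kingDist-BC = ℤP.+-injective (begin
    + kingDist B C       ≡⟨ ≼ₓ⇒kingDist (Main⇒≼ₓC {B} Main-B) ⟩
    + (k ℕ.+ l ℕ.+ 1) - L ≡⟨ cong (_- L) +[k+l+1] ⟩
    K ℤ.+ L ℤ.+ 1ℤ - L   ≡⟨ cancel K L ⟩
    K ℤ.+ 1ℤ             ≡⟨ ℤP.pos-+ k 1 ⟨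
    + (k + 1)            ∎)
    where
    open ≡-Reasoning
    cancel : ∀ K L → K ℤ.+ L ℤ.+ 1ℤ - L ≡ K ℤ.+ 1ℤ
    cancel = solve-∀

  kingDist-DC : kingDist D C ≡ l + 1
  kingDist-DC = ℤP.+-injective (begin
    + kingDist D C       ≡⟨ ≼ₓ⇒kingDist (Main⇒≼ₓC {D} Main-D) ⟩
    + (k ℕ.+ l ℕ.+ 1) - K ≡⟨ cong (_- K) +[k+l+1] ⟩
    K ℤ.+ L ℤ.+ 1ℤ - K   ≡⟨ cancel K L ⟩
    L ℤ.+ 1ℤ             ≡⟨ ℤP.pos-+ l 1 ⟨
    + (l + 1)            ∎)
    where
    open ≡-Reasoning
    cancel : ∀ K L → K ℤ.+ L ℤ.+ 1ℤ - K ≡ L ℤ.+ 1ℤ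
    cancel = solve-∀

  kingDist-BD : kingDist B D ≡ k + l + 1
  kingDist-BD = ℤP.+-injective (begin
    + kingDist B D        ≡⟨ ≼ᵧ⇒kingDist (Main⇒B≼ᵧ {D} Main-D) ⟩
    + suc k - - L         ≡⟨ cong (_- - L) (ℤP.pos-+ 1 k) ⟩
    1ℤ ℤ.+ K - - L        ≡⟨ shuffle K L ⟩
    K ℤ.+ L ℤ.+ 1ℤ        ≡⟨ +[k+l+1] ⟨
    + (k + l + 1)         ∎)
    where
    open ≡-Reasoning
    shuffle : ∀ K L → 1ℤ ℤ.+ K - - L ≡ K ℤ.+ L ℤ.+ 1ℤ
    shuffle = solve-∀

  kingDist-AC : kingDist A C ≡ k + l + 2
  kingDist-AC = begin
    kingDist A C                  ≡⟨ interval-AC {B} (inj₁ Main-B) ⟨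
    kingDist A B + kingDist B C   ≡⟨ cong₂ _+_ kingDist-AB kingDist-BC ⟩
    (l + 1) + (k + 1)             ≡⟨ solve-ℕ k l ⟩
    k + l + 2                     ∎
    where
    open ≡-Reasoning
    open import Data.Nat.Tactic.RingSolver using () renaming (solve-∀ to solve-∀ℕ)
    solve-ℕ : ∀ k l → (l + 1) + (k + 1) ≡ k + l + 2
    solve-ℕ = solve-∀ℕ

  EH-sym : Symmetric (EH k l)
  EH-sym {u} {v} (hu , hv , king) = hv , hu , trans (kingDist-sym v u) king

  walk-Main : ∀ {p q} → Main p → Main q → Walk (EH k l) p q (kingDist p q)
  walk-Main = greedyWalk (λ mu mv king → inj₁ mu , inj₁ mv , king)

  -- If t q = -1 then s q ≥ 1, because s q - t q = 2 y is even.
  A-successor : ∀ {q} → Main q → ∃ λ p₀ → Main p₀ × King A p₀ × p₀ ≼ₓ q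
  A-successor {x , y} (0≤s , _ , -1≤t , _) with 0ℤ ℤ.≤? x - y
  ... | yes 0≤t = (0ℤ , 0ℤ) , (ℤP.≤-refl , +≤+ z≤n , -≤+ , +≤+ z≤n) , refl , (0≤s , 0≤t)
  ... | no 0≰t = (0ℤ , 1ℤ) , (+≤+ z≤n , +≤+ (ℕP.m≤n+m 1 (2 ℕ.* k)) , ℤP.≤-refl , -≤+) , refl , (1≤s , -1≤t)
    where
    odd : ∀ x y → (x ℤ.+ y - 0ℤ) ℤ.+ (0ℤ - (1ℤ ℤ.+ (x - y))) ≡ 1ℤ ℤ.+ ((y - 1ℤ) ℤ.+ (y - 1ℤ)) - 0ℤ
    odd = solve-∀
    even : ∀ x y → ((y - 1ℤ) ℤ.+ (y - 1ℤ) - 0ℤ) ℤ.+ (x - y - -1ℤ) ≡ x ℤ.+ y - 1ℤ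
    even = solve-∀
    0≤2[y-1] = 0≤1+2i⇒0≤2i (y - 1ℤ) (≤-by-sum 0≤s (ℤP.i<j⇒suc[i]≤j (ℤP.≰⇒> 0≰t)) (odd x y))
    1≤s = ≤-by-sum 0≤2[y-1] -1≤t (even x y)

  King-C : ∀ {p} → Main p → proj₁ p ≡ K ℤ.+ L → King p C
  King-C {p} mp x≡K+L = ℤP.+-injective (begin
    + kingDist p C                      ≡⟨ ≼ₓ⇒kingDist (Main⇒≼ₓC {p} mp) ⟩
    + (k ℕ.+ l ℕ.+ 1) - proj₁ p         ≡⟨ cong₂ _-_ +[k+l+1] x≡K+L ⟩
    K ℤ.+ L ℤ.+ 1ℤ - (K ℤ.+ L)          ≡⟨ cancel K L ⟩
    1ℤ                                  ∎)
    where
    open ≡-Reasoning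
    cancel : ∀ K L → K ℤ.+ L ℤ.+ 1ℤ - (K ℤ.+ L) ≡ 1ℤ
    cancel = solve-∀

  C⁻ C⁻⁻ : Point
  C⁻ = (K ℤ.+ L , K - L ℤ.+ 1ℤ)
  C⁻⁻ = (K ℤ.+ L , K - L)

  s-C⁻ : s C⁻ ≡ + (2 ℕ.* k ℕ.+ 1)
  s-C⁻ = trans (sum K L) (sym +[2k+1])
    where
    sum : ∀ K L → (K ℤ.+ L) ℤ.+ (K - L ℤ.+ 1ℤ) ≡ K ℤ.+ K ℤ.+ 1ℤ
    sum = solve-∀

  t-C⁻ : t C⁻ ≡ + (2 ℕ.* l) - 1ℤ
  t-C⁻ = trans (difference K L) (cong (_- 1ℤ) (sym (+[2n] l)))
    where
    difference : ∀ K L → (K ℤ.+ L) - (K - L ℤ.+ 1ℤ) ≡ L ℤ.+ L - 1ℤ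
    difference = solve-∀

  s-C⁻⁻ : s C⁻⁻ ≡ + (2 ℕ.* k)
  s-C⁻⁻ = trans (sum K L) (sym (+[2n] k))
    where
    sum : ∀ K L → (K ℤ.+ L) ℤ.+ (K - L) ≡ K ℤ.+ K
    sum = solve-∀

  t-C⁻⁻ : t C⁻⁻ ≡ + (2 ℕ.* l)
  t-C⁻⁻ = trans (difference K L) (sym (+[2n] l))
    where
    difference : ∀ K L → (K ℤ.+ L) - (K - L) ≡ L ℤ.+ L
    difference = solve-∀

  Main-C⁻ : Main C⁻
  Main-C⁻ = subst (0ℤ ℤ.≤_) (sym s-C⁻) (+≤+ z≤n) , subst (ℤ._≤ + (2 ℕ.* k ℕ.+ 1)) (sym s-C⁻) ℤP.≤-refl ,
            subst (-1ℤ ℤ.≤_) (sym t-C⁻) (ℤP.+-monoˡ-≤ -1ℤ (+≤+ (z≤n {2 ℕ.* l}))) ,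
            subst (ℤ._≤ + (2 ℕ.* l)) (sym t-C⁻) (ℤP.i-j≤i (+ (2 ℕ.* l)) 1ℤ)

  Main-C⁻⁻ : Main C⁻⁻
  Main-C⁻⁻ = subst (0ℤ ℤ.≤_) (sym s-C⁻⁻) (+≤+ z≤n) ,
             subst (ℤ._≤ + (2 ℕ.* k ℕ.+ 1)) (sym s-C⁻⁻) (+≤+ (ℕP.m≤m+n (2 ℕ.* k) 1)) ,
             subst (-1ℤ ℤ.≤_) (sym t-C⁻⁻) -≤+ , subst (ℤ._≤ + (2 ℕ.* l)) (sym t-C⁻⁻) ℤP.≤-refl

  -- If s q = 2k + 1 then t q ≤ 2l - 1, because s q - t q = 2 y is even.
  C-predecessor : ∀ {q} → Main q → ∃ λ p₀ → Main p₀ × King p₀ C × q ≼ₓ p₀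
  C-predecessor {x , y} (_ , s≤ , _ , t≤) with x ℤ.+ y ℤ.≤? + (2 ℕ.* k)
  ... | yes s≤2k = C⁻⁻ , Main-C⁻⁻ , King-C {C⁻⁻} Main-C⁻⁻ refl ,
                   (subst (x ℤ.+ y ℤ.≤_) (sym s-C⁻⁻) s≤2k , subst (x - y ℤ.≤_) (sym t-C⁻⁻) t≤)
  ... | no s≰2k = C⁻ , Main-C⁻ , King-C {C⁻} Main-C⁻ refl ,
                  (subst (x ℤ.+ y ℤ.≤_) (sym s-C⁻) s≤ , subst (x - y ℤ.≤_) (sym t-C⁻) t≤2l-1)
    where
    odd : ∀ x y K L → (L ℤ.+ L - (x - y)) ℤ.+ (x ℤ.+ y - (1ℤ ℤ.+ (K ℤ.+ K)))
                      ≡ 1ℤ ℤ.+ ((L - K - 1ℤ ℤ.+ y) ℤ.+ (L - K - 1ℤ ℤ.+ y)) - 0ℤ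
    odd = solve-∀
    even : ∀ x y K L → ((L - K - 1ℤ ℤ.+ y) ℤ.+ (L - K - 1ℤ ℤ.+ y) - 0ℤ) ℤ.+ (K ℤ.+ K ℤ.+ 1ℤ - (x ℤ.+ y))
                       ≡ L ℤ.+ L - 1ℤ - (x - y)
    even = solve-∀
    0≤2i = 0≤1+2i⇒0≤2i (L - K - 1ℤ ℤ.+ y)
      (≤-by-sum (subst (x - y ℤ.≤_) (+[2n] l) t≤)
        (subst (λ b → 1ℤ ℤ.+ b ℤ.≤ x ℤ.+ y) (+[2n] k) (ℤP.i<j⇒suc[i]≤j (ℤP.≰⇒> s≰2k))) (odd x y K L))
    t≤2l-1 : x - y ℤ.≤ + (2 ℕ.* l) - 1ℤ
    t≤2l-1 = subst (λ b → x - y ℤ.≤ b - 1ℤ) (sym (+[2n] l))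
      (≤-by-sum 0≤2i (subst (x ℤ.+ y ℤ.≤_) +[2k+1] s≤) (even x y K L))

  walk-from-A : ∀ {q} → Main q → Walk (EH k l) A q (kingDist A q)
  walk-from-A {q} mq with A-successor {q} mq
  ... | p₀ , m₀ , king , p₀≼q = castʷ length ((inA , inj₁ m₀ , king) ∷ walk-Main {p₀} {q} m₀ mq)
    where
    length : 1 + kingDist p₀ q ≡ kingDist A q
    length = trans (cong (_+ kingDist p₀ q) (sym king)) (kingDist-≼ₓ-+ (Main⇒A≼ₓ {p₀} m₀) p₀≼q)

  walk-to-C : ∀ {q} → Main q → Walk (EH k l) q C (kingDist q C)
  walk-to-C {q} mq with C-predecessor {q} mq
  ... | p₀ , m₀ , king , q≼p₀ = castʷ length (walk-Main {q} {p₀} mq m₀ ++ʷ ((inj₁ m₀ , inC , king) ∷ []))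
    where
    length : kingDist q p₀ + 1 ≡ kingDist q C
    length = trans (cong (_+_ (kingDist q p₀)) (sym king)) (kingDist-≼ₓ-+ q≼p₀ (Main⇒≼ₓC {p₀} m₀))

  geodesic-reverse : ∀ {p q} → Walk (EH k l) p q (kingDist p q) → Walk (EH k l) q p (kingDist q p)
  geodesic-reverse {p} {q} w = castʷ (kingDist-sym p q) (reverseʷ EH-sym w)

  geodesic-refl : ∀ p → Walk (EH k l) p p (kingDist p p)
  geodesic-refl p = castʷ (sym (kingDist-refl p)) []

  walk-A-C : Walk (EH k l) A C (kingDist A C)
  walk-A-C = castʷ (interval-AC {B} (inj₁ Main-B)) (walk-from-A {B} Main-B ++ʷ walk-to-C {B} Main-B)

  walk-H : ∀ {p q} → InH k l p → InH k l q → Walk (EH k l) p q (kingDist p q)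
  walk-H (inj₁ mp) (inj₁ mq) = walk-Main mp mq
  walk-H (inj₁ mp) (inj₂ (inj₁ refl)) = geodesic-reverse (walk-from-A mp)
  walk-H (inj₁ mp) (inj₂ (inj₂ refl)) = walk-to-C mp
  walk-H (inj₂ (inj₁ refl)) (inj₁ mq) = walk-from-A mq
  walk-H (inj₂ (inj₁ refl)) (inj₂ (inj₁ refl)) = geodesic-refl A
  walk-H (inj₂ (inj₁ refl)) (inj₂ (inj₂ refl)) = walk-A-C
  walk-H (inj₂ (inj₂ refl)) (inj₁ mq) = geodesic-reverse (walk-to-C mq)
  walk-H (inj₂ (inj₂ refl)) (inj₂ (inj₁ refl)) = geodesic-reverse walk-A-C
  walk-H (inj₂ (inj₂ refl)) (inj₂ (inj₂ refl)) = geodesic-refl C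

  H-dist : ∀ {p q} → InH k l p → InH k l q → Dist (EH k l) p q (kingDist p q)
  H-dist hp hq = walk-H hp hq , λ m w → kingDist≤length (λ e → proj₂ (proj₂ e)) w

module NonExpandingIsometry (k l : ℕ) {V : Set} {E : V → V → Set} (E-sym : Symmetric E) (φ : Point → V)
  (φ-nonExpanding : ∀ {p q} → InH k l p → InH k l q → InDisk E (φ p) (kingDist p q) (φ q))
  (φ-AC : Dist≥ E (φ (cornerA k l)) (φ (cornerC k l)) (kingDist (cornerA k l) (cornerC k l)))
  (φ-BD : Dist≥ E (φ (cornerB k l)) (φ (cornerD k l)) (kingDist (cornerB k l) (cornerD k l))) where

  open Geometry k l

  Dist≥-from-A : ∀ {p} → InH k l p → Dist≥ E (φ A) (φ p) (kingDist A p)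
  Dist≥-from-A hp = Dist≥-interval (subst (Dist≥ E (φ A) (φ C)) (sym (interval-AC hp)) φ-AC) (φ-nonExpanding hp inC)

  Dist≥-from-C : ∀ {p} → InH k l p → Dist≥ E (φ C) (φ p) (kingDist C p)
  Dist≥-from-C {p} hp =
    Dist≥-interval (subst (Dist≥ E (φ C) (φ A)) interval-CA (Dist≥-sym E-sym φ-AC)) (φ-nonExpanding hp inA)
    where
    open ≡-Reasoning
    interval-CA : kingDist A C ≡ kingDist C p + kingDist p A
    interval-CA = begin
      kingDist A C                 ≡⟨ interval-AC hp ⟨
      kingDist A p + kingDist p C  ≡⟨ ℕP.+-comm (kingDist A p) (kingDist p C) ⟩
      kingDist p C + kingDist A p  ≡⟨ cong₂ _+_ (kingDist-sym p C) (kingDist-sym A p) ⟩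
      kingDist C p + kingDist p A  ∎

  Dist≥-from-B : ∀ {p} → Main p → Dist≥ E (φ B) (φ p) (kingDist B p)
  Dist≥-from-B {p} mp = Dist≥-interval (subst (Dist≥ E (φ B) (φ D)) (sym (interval-BD {p} mp)) φ-BD)
    (φ-nonExpanding (inj₁ mp) (inj₁ Main-D))

  -- On Main, x + 1 and y + l are the king distances from A and B, which φ preserves exactly.
  Dist≥-Main : ∀ {p q} → Main p → Main q → Dist≥ E (φ p) (φ q) (kingDist p q)
  Dist≥-Main {p} {q} mp mq m w = ℕP.⊔-lub
    (∣a-b∣≤-offsets {a = proj₁ p} {proj₁ q} {proj₁ A} (≼ₓ⇒kingDist (Main⇒A≼ₓ {p} mp)) (≼ₓ⇒kingDist (Main⇒A≼ₓ {q} mq))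
      (Lipschitz inA (Dist≥-from-A (inj₁ mp)) (Dist≥-from-A (inj₁ mq))))
    (∣a-b∣≤-offsets {a = proj₂ p} {proj₂ q} {proj₂ B} (≼ᵧ⇒kingDist (Main⇒B≼ᵧ {p} mp)) (≼ᵧ⇒kingDist (Main⇒B≼ᵧ {q} mq))
      (Lipschitz (inj₁ Main-B) (Dist≥-from-B mp) (Dist≥-from-B mq)))
    where
    Lipschitz : ∀ {P} → InH k l P → Dist≥ E (φ P) (φ p) (kingDist P p) → Dist≥ E (φ P) (φ q) (kingDist P q) →
      kingDist P p ≤ kingDist P q + m × kingDist P q ≤ kingDist P p + m
    Lipschitz hP from-p from-q =
      Dist≥-Lipschitz (φ-nonExpanding hP (inj₁ mq)) from-p (reverseʷ E-sym w) ,
      Dist≥-Lipschitz (φ-nonExpanding hP (inj₁ mp)) from-q w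

  Dist≥-H : ∀ {p q} → InH k l p → InH k l q → Dist≥ E (φ p) (φ q) (kingDist p q)
  Dist≥-H (inj₂ (inj₁ refl)) hq = Dist≥-from-A hq
  Dist≥-H (inj₂ (inj₂ refl)) hq = Dist≥-from-C hq
  Dist≥-H {p} (inj₁ mp) (inj₂ (inj₁ refl)) =
    subst (Dist≥ E (φ p) (φ A)) (kingDist-sym A p) (Dist≥-sym E-sym (Dist≥-from-A (inj₁ mp)))
  Dist≥-H {p} (inj₁ mp) (inj₂ (inj₂ refl)) =
    subst (Dist≥ E (φ p) (φ C)) (kingDist-sym C p) (Dist≥-sym E-sym (Dist≥-from-C (inj₁ mp)))
  Dist≥-H (inj₁ mp) (inj₁ mq) = Dist≥-Main mp mq

  φ-isometric : ∀ {p q} → InH k l p → InH k l q → Dist E (φ p) (φ q) (kingDist p q)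
  φ-isometric hp hq = InDisk∧Dist≥⇒Dist (φ-nonExpanding hp hq) (Dist≥-H hp hq)

module H₂Embedding (k l : ℕ) {V : Set} {E : V → V → Set} (E-sym : Symmetric E) (helly : Helly E) (a b c d : V)
  (dac : Dist E a c (k + l + 2)) (dbd : Dist E b d (k + l + 1))
  (dab : Dist E a b (l + 1)) (dcd : Dist E c d (l + 1))
  (dbc : Dist E b c (k + 1)) (dda : Dist E d a (k + 1)) where

  open Geometry k l
  open HellyExtension E-sym helly _≟ₚ_ kingDist kingDist-refl kingDist-sym kingDist-triangle

  corners : List (Point × V)
  corners = (A , a) ∷ (B , b) ∷ (C , c) ∷ (D , d) ∷ []

  corners-nonExpanding : NonExpanding corners
  corners-nonExpanding =
    ∷-nonExpanding (∷-nonExpanding (∷-nonExpanding (∷-nonExpanding (λ ()) (λ ())) at-C) at-B) at-A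
    where
    within : ∀ {u v m r} → r ≡ m → Dist E u v m → InDisk E u r v
    within r≡m d = InDisk-mono (ℕP.≤-reflexive (sym r≡m)) (InDisk-walk (proj₁ d))
    at-C : Compatible ((D , d) ∷ []) C c
    at-C (here refl) = within (trans (kingDist-sym C D) kingDist-DC) dcd
    at-B : Compatible ((C , c) ∷ (D , d) ∷ []) B b
    at-B (here refl) = within kingDist-BC dbc
    at-B (there (here refl)) = within kingDist-BD dbd
    at-A : Compatible ((B , b) ∷ (C , c) ∷ (D , d) ∷ []) A a
    at-A (here refl) = within kingDist-AB dab
    at-A (there (here refl)) = within kingDist-AC dac
    at-A (there (there (here refl))) = InDisk-sym E-sym (within kingDist-AD dda)

  -- Every point of Main is recovered from its king distances to A and B.
  gridPoint : ℕ → ℕ → Point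
  gridPoint i j = (+ i - 1ℤ , + j - L)

  grid : List Point
  grid = A ∷ C ∷ cartesianProductWith gridPoint (upTo (suc (k + l + 2))) (upTo (suc (k + l + 1)))

  gridPoint-Main : ∀ {p} → Main p → gridPoint (kingDist A p) (kingDist B p) ≡ p
  gridPoint-Main {x , y} mp = cong₂ _,_
    (trans (cong (_- 1ℤ) (≼ₓ⇒kingDist (Main⇒A≼ₓ {x , y} mp))) (shift x 1ℤ))
    (trans (cong (_- L) (≼ᵧ⇒kingDist (Main⇒B≼ᵧ {x , y} mp))) (shift y L))
    where
    shift : ∀ x o → x - - o - o ≡ x
    shift = solve-∀

  InH⇒∈grid : ∀ {p} → InH k l p → p ∈ grid
  InH⇒∈grid (inj₂ (inj₁ refl)) = here refl
  InH⇒∈grid (inj₂ (inj₂ refl)) = there (here refl)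
  InH⇒∈grid {p} (inj₁ mp) = there (there (subst (_∈ _) (gridPoint-Main {p} mp)
    (∈-cartesianProductWith⁺ gridPoint (∈-upTo⁺ (s≤s (bounded {kingDist A p} (interval-AC {p} (inj₁ mp)) kingDist-AC)))
                                        (∈-upTo⁺ (s≤s (bounded {kingDist B p} (interval-BD {p} mp) kingDist-BD))))))
    where
    bounded : ∀ {i j r n} → i + j ≡ r → r ≡ n → i ≤ n
    bounded {i} {j} i+j≡r r≡n = subst (i ≤_) (trans i+j≡r r≡n) (ℕP.m≤m+n i j)

  -- Kept abstract so that checking the corner equations never unfolds the Helly construction.
  abstract
    extension : NonExpandingExtension corners grid
    extension = nonExpanding-extension corners-nonExpanding grid a

  open NonExpandingExtension extension using (nonExpanding-map; agrees)

  φ : Point → V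
  φ = NonExpandingExtension.map extension

  φ-nonExpanding : ∀ {p q} → InH k l p → InH k l q → InDisk E (φ p) (kingDist p q) (φ q)
  φ-nonExpanding hp hq = nonExpanding-map (InH⇒∈grid hp) (InH⇒∈grid hq)

  φ-A : φ A ≡ a
  φ-A = agrees (here refl) (InH⇒∈grid inA)

  φ-B : φ B ≡ b
  φ-B = agrees (there (here refl)) (InH⇒∈grid (inj₁ Main-B))

  φ-C : φ C ≡ c
  φ-C = agrees (there (there (here refl))) (InH⇒∈grid inC)

  φ-D : φ D ≡ d
  φ-D = agrees (there (there (there (here refl)))) (InH⇒∈grid (inj₁ Main-D))

  φ-isometric : ∀ {p q} → InH k l p → InH k l q → Dist E (φ p) (φ q) (kingDist p q)
  φ-isometric = NonExpandingIsometry.φ-isometric k l E-sym φ φ-nonExpanding φ-AC φ-BD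
    where
    φ-AC : Dist≥ E (φ A) (φ C) (kingDist A C)
    φ-AC = subst₂ (λ u v → Dist≥ E u v (kingDist A C)) (sym φ-A) (sym φ-C)
      (subst (Dist≥ E a c) (sym kingDist-AC) (proj₂ dac))
    φ-BD : Dist≥ E (φ B) (φ D) (kingDist B D)
    φ-BD = subst₂ (λ u v → Dist≥ E u v (kingDist B D)) (sym φ-B) (sym φ-D)
      (subst (Dist≥ E b d) (sym kingDist-BD) (proj₂ dbd))

lemma6 : (k l n : ℕ) (E : Fin n → Fin n → Set) →
    IsFiniteSimpleConnectedGraph n E →
    Helly E →
    (a b c d ab ad cb cd : Fin n) →
    Triangle E a ab ad → Triangle E c cb cd →
    (P₁ : Fin (suc l) → Fin n) → IsPath E l P₁ ab b →
    (P₂ : Fin (suc k) → Fin n) → IsPath E k P₂ b cb →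
    (P₃ : Fin (suc l) → Fin n) → IsPath E l P₃ cd d →
    (P₄ : Fin (suc k) → Fin n) → IsPath E k P₄ d ad →
    (∀ (i j : Fin 4) (m : ℕ) →
      Dist (SubEdge k l a ab ad c cb cd P₁ P₂ P₃ P₄) (corner4 a b c d i) (corner4 a b c d j) m
        ⇔ Dist E (corner4 a b c d i) (corner4 a b c d j) m) →
    Dist E a c (k + l + 2) → Dist E b d (k + l + 1) →
    Dist E a b (l + 1) → Dist E c d (l + 1) →
    Dist E b c (k + 1) → Dist E d a (k + 1) →
    Σ (Point → Fin n) λ φ →
      (∀ p q → InH k l p → InH k l q → φ p ≡ φ q → p ≡ q) ×
      (∀ p q → InH k l p → InH k l q → (King p q ⇔ E (φ p) (φ q))) ×
      (∀ p q → InH k l p → InH k l q → ∀ m → (Dist (EH k l) p q m ⇔ Dist E (φ p) (φ q) m)) ×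
      φ (cornerA k l) ≡ a × φ (cornerB k l) ≡ b × φ (cornerC k l) ≡ c × φ (cornerD k l) ≡ d
lemma6 k l n E G helly a b c d _ _ _ _ _ _ _ _ _ _ _ _ _ _ _ dac dbd dab dcd dbc dda =
  φ , injective , adjacent , isometric , φ-A , φ-B , φ-C , φ-D
  where
  open IsFiniteSimpleConnectedGraph G using (irrefl) renaming (sym to E-sym)
  open H₂Embedding k l E-sym helly a b c d dac dbd dab dcd dbc dda
  open Geometry k l using (H-dist)

  injective : ∀ p q → InH k l p → InH k l q → φ p ≡ φ q → p ≡ q
  injective p q hp hq φp≡φq =
    kingDist≡0⇒≡ (Dist-refl⇒0 (subst (λ v → Dist E (φ p) v (kingDist p q)) (sym φp≡φq) (φ-isometric hp hq)))

  adjacent : ∀ p q → InH k l p → InH k l q → (King p q ⇔ E (φ p) (φ q))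
  adjacent p q hp hq = mk⇔
    (λ king → Walk-1⇒E (proj₁ (subst (Dist E (φ p) (φ q)) king (φ-isometric hp hq))))
    (λ e → E⇒Dist-1 irrefl e (φ-isometric hp hq))

  isometric : ∀ p q → InH k l p → InH k l q → ∀ m → (Dist (EH k l) p q m ⇔ Dist E (φ p) (φ q) m)
  isometric p q hp hq = Dist-⇔ (H-dist hp hq) (φ-isometric hp hq)
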